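{- \begin{enumerate} \item $\mathit{AX}(\mathcal{L}_{\mathsf{D}})$ is sound and complete for the validities of $\mathcal{L}_{\mathsf{D}}$. \item $\mathit{AX}(\mathcal{L}_{\mathsf{I}})$ is sound and complete for the validities of $\mathcal{L}_{\mathsf{I}}$. \end{enumerate}
   Context: Let $\mathit{PROP}$ be a fixed countably infinite set of proposition symbols. An SD-model (state description model) is any (possibly empty) set $W$ of assignments $w:\mathit{PROP}\to\{0,1\}$. The logic $\mathcal{L}_{\mathsf{D}}$ has formulae $\varphi ::= p \mid \neg\varphi \mid (\varphi\to\varphi) \mid \mathsf{D}(\varphi_1,\ldots,\varphi_k;\varphi)$ for $p\in\mathit{PROP}$, $k\in\mathbb{N}$; $\mathsf{C}\varphi$ denotes $\mathsf{D}(\epsilon;\varphi)$ with $\epsilon$ the empty sequence, and $\land,\lor,\leftrightarrow$ are the usual abbreviations. Semantics at $w\in W$: $W,w\models p$ iff $w(p)=1$; negation and implication are classical; $W,w\models \mathsf{D}(\varphi_1,\ldots,\varphi_k;\psi)$ iff for all $u,v\in W$, if $(W,u\models\varphi_i \Leftrightarrow W,v\models\varphi_i)$ for all $i\le k$, then $(W,u\models\psi\Leftrightarrow W,v\models\psi)$. (So $\mathsf{C}\varphi$ holds iff the truth value of $\varphi$ is constant on $W$.) The logic $\mathcal{L}_{\mathsf{I}}$ has formulae $\varphi ::= p \mid \neg\varphi \mid (\varphi\to\varphi) \mid (\varphi_1,\ldots,\varphi_k)\,\mathsf{I}_{(\theta_1,\ldots,\theta_m)}(\psi_1,\ldots,\psi_n)$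 with $k,n\ge 1$, $m\ge 0$. Atoms and Boolean connectives are interpreted as in $\mathcal{L}_{\mathsf{D}}$, and $W,w\models(\varphi_1,\ldots,\varphi_k)\,\mathsf{I}_{(\theta_1,\ldots,\theta_m)}(\psi_1,\ldots,\psi_n)$ iff for all $w_1,w_2\in W$ agreeing on the truth values of all $\theta_i$, there is $v\in W$ agreeing with $w_1$ on all $\theta_i$ and all $\varphi_i$, and agreeing with $w_2$ on all $\psi_i$. A formula is valid if it is true at every $w$ in every SD-model $W$. For a finite nonempty set of formulae $\Phi=\{\varphi_1,\ldots,\varphi_k\}$, $\mathit{Conj}(\Phi)$ is the set of all conjunctions $\psi_1\wedge\cdots\wedge\psi_k$ with each $\psi_i\in\{\varphi_i,\neg\varphi_i\}$ (types over $\Phi$), and $\mathit{DNF}(\Phi)$ is the set of all disjunctions $\bigvee U$ for $U\subseteq \mathit{Conj}(\Phi)$ (with $\bigvee\emptyset := p\wedge\neg p$); also $\mathit{Conj}(\emptyset)=\{\top\}$ and $\mathit{DNF}(\emptyset)=\{\top,\bot\}$, where $\top := p\vee\neg p$, $\bot:=p\wedge\neg p$. Abbreviations: in $\mathcal{L}_{\mathsf{D}}$, $[\mathsf{u}]\varphi := \varphi\wedge\mathsf{C}\varphi$; in $\mathcal{L}_{\mathsf{I}}$, $[\mathsf{u}']\varphi := \varphi\wedge \varphi\,\mathsf{I}\,\varphi$ and $\langle\mathsf{u}'\rangle\varphi := \neg[\mathsf{u}']\neg\varphi$. The system $\mathit{AX}(\mathcal{L}_{\mathsf{C}})$ (for the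 fragment of $\mathcal{L}_{\mathsf{D}}$ with only $\mathsf{C}$) has axiom schemes: a complete set of axioms for propositional logic; $\mathsf{C}\top$; $\mathsf{C}\varphi\leftrightarrow\mathsf{C}\neg\varphi$; $\mathsf{C}(\varphi\wedge\mathsf{C}\varphi)$; $\mathsf{C}\varphi\wedge\mathsf{C}\psi\to\mathsf{C}(\varphi\wedge\psi)$; $\varphi\wedge\mathsf{C}\varphi\wedge\mathsf{C}(\varphi\to\psi)\to\mathsf{C}\psi$; and rules Modus Ponens and EQ$_{\mathsf{C}}$: if $\vdash\varphi\leftrightarrow\psi$ then $\vdash\mathsf{C}\varphi\leftrightarrow\mathsf{C}\psi$. $\mathit{AX}(\mathcal{L}_{\mathsf{D}})$ is $\mathit{AX}(\mathcal{L}_{\mathsf{C}})$ extended, for each positive integer $k$, by the axiom scheme $\mathsf{D}(\varphi_1,\ldots,\varphi_k;\psi)\leftrightarrow \bigvee_{\chi\in\mathit{DNF}(\varphi_1,\ldots,\varphi_k)}[\mathsf{u}](\chi\leftrightarrow\psi)$. $\mathit{AX}_0(\mathcal{L}_{\mathsf{I}})$ is obtained from $\mathit{AX}(\mathcal{L}_{\mathsf{C}})$ by replacing every $\mathsf{C}\theta$ by $\theta\,\mathsf{I}\,\theta$ (in axioms and in the rule EQ). $\mathit{AX}(\mathcal{L}_{\mathsf{I}})$ is $\mathit{AX}_0(\mathcal{L}_{\mathsf{I}})$ extended, for all $m\in\mathbb{N}$ and $k,n\in\mathbb{Z}_+$, by the axiom scheme $(\varphi_1,\ldots,\varphi_k)\,\mathsf{I}_{(\theta_1,\ldots,\theta_m)}(\psi_1,\ldots,\psi_n)\leftrightarrow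 \bigwedge_{(\varphi,\theta,\psi)\in B}\big((\langle\mathsf{u}'\rangle(\theta\wedge\varphi)\wedge\langle\mathsf{u}'\rangle(\theta\wedge\psi))\to\langle\mathsf{u}'\rangle(\theta\wedge\varphi\wedge\psi)\big)$, where $B=\mathit{Conj}(\{\varphi_1,\ldots,\varphi_k\})\times\mathit{Conj}(\{\theta_1,\ldots,\theta_m\})\times\mathit{Conj}(\{\psi_1,\ldots,\psi_n\})$. -}

module Defs where

open import Data.Nat using (ℕ)
open import Data.Bool using (Bool; true)
open import Data.List using (List; []; _∷_; [_]; map; concatMap; _++_)
open import Data.List.NonEmpty using (List⁺; _∷_)
open import Data.Product using (_×_; Σ)
open import Data.Unit using (⊤)
open import Relation.Binary.PropositionalEquality using (_≡_)
open import Relation.Nullary using (¬_)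

Iff : Set → Set → Set
Iff A B = (A → B) × (B → A)

Assignment : Set
Assignment = ℕ → Bool

SDModel : Set₁
SDModel = Assignment → Set

signs : {A : Set} → (A → A) → List A → List (List A)
signs neg [] = [ [] ]
signs neg (x ∷ xs) = concatMap (λ l → (x ∷ l) ∷ (neg x ∷ l) ∷ []) (signs neg xs)

sublists : {A : Set} → List A → List (List A)
sublists [] = [ [] ]
sublists (x ∷ xs) = map (x ∷_) (sublists xs) ++ sublists xs

data FormD : Set where
  atomD : ℕ → FormD
  negD  : FormD → FormD
  impD  : FormD → FormD → FormD
  depD  : List FormD → FormD → FormD

mutual
  _,_⊨D_ : SDModel → Assignment → FormD → Set
  W , w ⊨D atomD p = w p ≡ true
  W , w ⊨D negD φ = ¬ (W , w ⊨D φ)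
  W , w ⊨D impD φ ψ = (W , w ⊨D φ) → (W , w ⊨D ψ)
  W , w ⊨D depD φs ψ =
    (u v : Assignment) → W u → W v → agreeD W u v φs →
    Iff (W , u ⊨D ψ) (W , v ⊨D ψ)

  agreeD : SDModel → Assignment → Assignment → List FormD → Set
  agreeD W u v [] = ⊤
  agreeD W u v (φ ∷ φs) = Iff (W , u ⊨D φ) (W , v ⊨D φ) × agreeD W u v φs

ValidD : FormD → Set₁
ValidD φ = (W : SDModel) (w : Assignment) → W w → W , w ⊨D φ

andD orD iffD : FormD → FormD → FormD
andD φ ψ = negD (impD φ (negD ψ))
orD φ ψ = impD (negD φ) ψ
iffD φ ψ = andD (impD φ ψ) (impD ψ φ)

topD botD : FormD
topD = orD (atomD 0) (negD (atomD 0))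
botD = andD (atomD 0) (negD (atomD 0))

CD : FormD → FormD
CD φ = depD [] φ

boxD : FormD → FormD
boxD φ = andD φ (CD φ)

bigAndD : List FormD → FormD
bigAndD [] = topD
bigAndD (x ∷ []) = x
bigAndD (x ∷ y ∷ xs) = andD x (bigAndD (y ∷ xs))

bigOrD : List FormD → FormD
bigOrD [] = botD
bigOrD (x ∷ []) = x
bigOrD (x ∷ y ∷ xs) = orD x (bigOrD (y ∷ xs))

ConjD : List FormD → List FormD
ConjD Φ = map bigAndD (signs negD Φ)

-- DNF(Φ) for nonempty Φ (the only case used by the axiom)
DNFD : List FormD → List FormD
DNFD Φ = map bigOrD (sublists (ConjD Φ))

data ProvD : FormD → Set where
  -- propositional logic (Łukasiewicz axioms; complete with MP for ¬,→)
  ax-K  : ∀ φ ψ → ProvD (impD φ (impD ψ φ))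
  ax-S  : ∀ φ ψ χ → ProvD (impD (impD φ (impD ψ χ)) (impD (impD φ ψ) (impD φ χ)))
  ax-N  : ∀ φ ψ → ProvD (impD (impD (negD φ) (negD ψ)) (impD ψ φ))
  ax-C⊤    : ProvD (CD topD)
  ax-C¬    : ∀ φ → ProvD (iffD (CD φ) (CD (negD φ)))
  ax-CC    : ∀ φ → ProvD (CD (andD φ (CD φ)))
  ax-C∧    : ∀ φ ψ → ProvD (impD (andD (CD φ) (CD ψ)) (CD (andD φ ψ)))
  ax-Cimp  : ∀ φ ψ → ProvD (impD (andD (andD φ (CD φ)) (CD (impD φ ψ))) (CD ψ))
  ax-D     : ∀ φ φs ψ →
             ProvD (iffD (depD (φ ∷ φs) ψ)
                         (bigOrD (map (λ χ → boxD (iffD χ ψ)) (DNFD (φ ∷ φs)))))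
  mp   : ∀ {φ ψ} → ProvD (impD φ ψ) → ProvD φ → ProvD ψ
  eq-C : ∀ {φ ψ} → ProvD (iffD φ ψ) → ProvD (iffD (CD φ) (CD ψ))

data FormI : Set where
  atomI : ℕ → FormI
  negI  : FormI → FormI
  impI  : FormI → FormI → FormI
  -- (φ1..φk) I_(θ1..θm) (ψ1..ψn), k,n ≥ 1, m ≥ 0
  indI  : List⁺ FormI → List FormI → List⁺ FormI → FormI

mutual
  _,_⊨I_ : SDModel → Assignment → FormI → Set
  W , w ⊨I atomI p = w p ≡ true
  W , w ⊨I negI φ = ¬ (W , w ⊨I φ)
  W , w ⊨I impI φ ψ = (W , w ⊨I φ) → (W , w ⊨I ψ)
  W , w ⊨I indI φs θs ψs =
    (w₁ w₂ : Assignment) → W w₁ → W w₂ → agreeI W w₁ w₂ θs →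
    Σ Assignment (λ v → W v × agreeI W v w₁ θs × agreeI⁺ W v w₁ φs × agreeI⁺ W v w₂ ψs)

  agreeI : SDModel → Assignment → Assignment → List FormI → Set
  agreeI W u v [] = ⊤
  agreeI W u v (φ ∷ φs) = Iff (W , u ⊨I φ) (W , v ⊨I φ) × agreeI W u v φs

  agreeI⁺ : SDModel → Assignment → Assignment → List⁺ FormI → Set
  agreeI⁺ W u v (φ ∷ φs) = Iff (W , u ⊨I φ) (W , v ⊨I φ) × agreeI W u v φs

ValidI : FormI → Set₁
ValidI φ = (W : SDModel) (w : Assignment) → W w → W , w ⊨I φ

andI orI iffI : FormI → FormI → FormI
andI φ ψ = negI (impI φ (negI ψ))
orI φ ψ = impI (negI φ) ψ
iffI φ ψ = andI (impI φ ψ) (impI ψ φ)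

topI : FormI
topI = orI (atomI 0) (negI (atomI 0))

CI : FormI → FormI
CI θ = indI (θ ∷ []) [] (θ ∷ [])

boxI' : FormI → FormI
boxI' φ = andI φ (CI φ)

diaI' : FormI → FormI
diaI' φ = negI (boxI' (negI φ))

bigAndI : List FormI → FormI
bigAndI [] = topI
bigAndI (x ∷ []) = x
bigAndI (x ∷ y ∷ xs) = andI x (bigAndI (y ∷ xs))

ConjI : List FormI → List FormI
ConjI Φ = map bigAndI (signs negI Φ)

indRHS : List FormI → List FormI → List FormI → FormI
indRHS φs θs ψs =
  bigAndI (concatMap (λ φ → concatMap (λ θ → map (λ ψ →
      impI (andI (diaI' (andI θ φ)) (diaI' (andI θ ψ)))
           (diaI' (andI θ (andI φ ψ))))
    (ConjI ψs)) (ConjI θs)) (ConjI φs))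

data ProvI : FormI → Set where
  ax-K  : ∀ φ ψ → ProvI (impI φ (impI ψ φ))
  ax-S  : ∀ φ ψ χ → ProvI (impI (impI φ (impI ψ χ)) (impI (impI φ ψ) (impI φ χ)))
  ax-N  : ∀ φ ψ → ProvI (impI (impI (negI φ) (negI ψ)) (impI ψ φ))
  ax-C⊤    : ProvI (CI topI)
  ax-C¬    : ∀ φ → ProvI (iffI (CI φ) (CI (negI φ)))
  ax-CC    : ∀ φ → ProvI (CI (andI φ (CI φ)))
  ax-C∧    : ∀ φ ψ → ProvI (impI (andI (CI φ) (CI ψ)) (CI (andI φ ψ)))
  ax-Cimp  : ∀ φ ψ → ProvI (impI (andI (andI φ (CI φ)) (CI (impI φ ψ))) (CI ψ))
  ax-I : ∀ φ φs θs ψ ψs →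
         ProvI (iffI (indI (φ ∷ φs) θs (ψ ∷ ψs)) (indRHS (φ ∷ φs) θs (ψ ∷ ψs)))
  mp   : ∀ {φ ψ} → ProvI (impI φ ψ) → ProvI φ → ProvI ψ
  eq-C : ∀ {φ ψ} → ProvI (iffI φ ψ) → ProvI (iffI (CI φ) (CI ψ))

-- Soundness is a direct check; the D and I axioms are sound because a dependence or
-- independence atom only depends on which types over its arguments are realised in the model.
-- For completeness both logics are reduced to the fragment L_C whose only modality is C.
-- The D and I axioms rewrite every proper dependence or independence atom into a Boolean
-- combination of C-formulas of smaller nesting depth (φ I φ is kept as the primitive C φ),
-- and the rewriting is both provable and truth-preserving. L_C is complete by a finite
-- canonical model: over the subformulas of a non-theorem, the worlds are the maximal consistent
-- sets containing every literal ℓ with Γ₀ ⊢ ℓ and Γ₀ ⊢ C ℓ, for a fixed maximal consistent Γ₀;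
-- then C φ holds in the model iff Γ₀ ⊢ C φ.
module Submission where

open import Defs
open import Level using (0ℓ)
open import Axiom.ExcludedMiddle using (ExcludedMiddle)
open import Function using (_∘_; id)
open import Data.Empty using (⊥; ⊥-elim)
open import Data.Unit using (⊤; tt)
open import Data.Sum as Sum using (_⊎_; inj₁; inj₂; [_,_])
open import Data.Product using (_×_; _,_; proj₁; proj₂; Σ; ∃-syntax)
open import Data.Bool using (true; false)
open import Data.Nat using (ℕ; zero; suc; _≤_; _⊔_; z≤n; s≤s)
open import Data.Nat.Properties using (≤-refl; ≤-trans; m≤m⊔n; m≤n⊔m; ⊔-lub)
open import Data.List using (List; []; _∷_; _++_; map; concatMap; filter)
open import Data.List.NonEmpty as List⁺ using (List⁺; toList)
open import Data.List.Membership.Propositional using (_∈_; find; lose)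
open import Data.List.Membership.Propositional.Properties
  using (∈-++⁺ˡ; ∈-++⁺ʳ; ∈-++⁻; ∈-map⁺; ∈-map⁻; ∈-concatMap⁺; ∈-concatMap⁻; ∈-filter⁺; ∈-filter⁻)
open import Data.List.Relation.Unary.Any as Any using (Any; here; there)
open import Data.List.Relation.Unary.All as All using (All; []; _∷_)
open import Data.List.Relation.Unary.All.Properties using (concat⁺; concat⁻; ++⁺)
  renaming (map⁺ to All-map⁺; map⁻ to All-map⁻)
open import Data.List.Relation.Binary.Subset.Propositional using (_⊆_)
open import Relation.Nullary using (¬_; Dec; yes; no; does)
open import Relation.Unary using (Decidable)
open import Relation.Binary.PropositionalEquality using (_≡_; refl; sym; subst; _≗_)

Iff-trans : ∀ {P Q R : Set} → Iff P Q → Iff Q R → Iff P R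
Iff-trans (f , g) (h , k) = h ∘ f , g ∘ k

Iff-sym : ∀ {P Q : Set} → Iff P Q → Iff Q P
Iff-sym (f , g) = g , f

Iff-× : ∀ {P Q R S : Set} → Iff P Q → Iff R S → Iff (P × R) (Q × S)
Iff-× (f , g) (h , k) = (λ (p , r) → f p , h r) , (λ (q , s) → g q , k s)

Iff-¬ : ∀ {P Q : Set} → Iff P Q → Iff (¬ P) (¬ Q)
Iff-¬ (f , g) = (λ np → np ∘ g) , (λ nq → nq ∘ f)

Iff-→ : ∀ {P Q R S : Set} → Iff P Q → Iff R S → Iff (P → R) (Q → S)
Iff-→ (f , g) (h , k) = (λ pr → h ∘ pr ∘ g) , (λ qs → k ∘ qs ∘ f)

filter-∈-sublists : ∀ {A : Set} {P : A → Set} (P? : Decidable P) l → filter P? l ∈ sublists l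
filter-∈-sublists P? [] = here refl
filter-∈-sublists P? (x ∷ l) with does (P? x)
... | true = ∈-++⁺ˡ (∈-map⁺ (x ∷_) (filter-∈-sublists P? l))
... | false = ∈-++⁺ʳ (map (x ∷_) (sublists l)) (filter-∈-sublists P? l)

∈-sublists-⊆ : ∀ {A : Set} (l : List A) {U} → U ∈ sublists l → U ⊆ l
∈-sublists-⊆ [] (here refl) ()
∈-sublists-⊆ (x ∷ l) p with ∈-++⁻ (map (x ∷_) (sublists l)) p
... | inj₂ q = there ∘ ∈-sublists-⊆ l q
... | inj₁ q with ∈-map⁻ (x ∷_) q
...   | U , q′ , refl = λ { (here refl) → here refl ; (there m) → there (∈-sublists-⊆ l q′ m) }

All-sublists : ∀ {A : Set} {P : A → Set} {l} → All P l → All (All P) (sublists l)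
All-sublists [] = [] ∷ []
All-sublists (p ∷ ps) = ++⁺ (All-map⁺ (All.map (p ∷_) (All-sublists ps))) (All-sublists ps)

All-concatMap : ∀ {A B : Set} {P : B → Set} (f : A → List B) {xs} →
                Iff (All P (concatMap f xs)) (All (All P ∘ f) xs)
All-concatMap f = All-map⁻ ∘ concat⁻ , concat⁺ ∘ All-map⁺

module Signs {F : Set} (neg : F → F) where

  ∈-signs⁻ : ∀ x xs {s} → s ∈ signs neg (x ∷ xs) →
             ∃[ l ] l ∈ signs neg xs × (s ≡ x ∷ l ⊎ s ≡ neg x ∷ l)
  ∈-signs⁻ x xs p with find (∈-concatMap⁻ (λ l → (x ∷ l) ∷ (neg x ∷ l) ∷ []) {xs = signs neg xs} p)
  ... | l , m , here refl = l , m , inj₁ refl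
  ... | l , m , there (here refl) = l , m , inj₂ refl

  ∈-signs⁺ : ∀ {x xs l y} → l ∈ signs neg xs → y ∈ x ∷ neg x ∷ [] → (y ∷ l) ∈ signs neg (x ∷ xs)
  ∈-signs⁺ {x} {xs} m y∈ =
    ∈-concatMap⁺ (λ l → (x ∷ l) ∷ (neg x ∷ l) ∷ []) {xs = signs neg xs} (lose m (∈-map⁺ (_∷ _) y∈))

  All-signs : ∀ {P : F → Set} → (∀ {x} → P x → P (neg x)) →
              ∀ {xs} → All P xs → All (All P) (signs neg xs)
  All-signs P-neg [] = [] ∷ []
  All-signs P-neg {x ∷ xs} (p ∷ ps) =
    concat⁺ (All-map⁺ (All.map (λ q → (p ∷ q) ∷ (P-neg p ∷ q) ∷ []) (All-signs P-neg ps)))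

module Hilbert {F : Set} (neg : F → F) (imp : F → F → F) (Prov : F → Set)
  (K : ∀ φ ψ → Prov (imp φ (imp ψ φ)))
  (S : ∀ φ ψ χ → Prov (imp (imp φ (imp ψ χ)) (imp (imp φ ψ) (imp φ χ))))
  (N : ∀ φ ψ → Prov (imp (imp (neg φ) (neg ψ)) (imp ψ φ)))
  (MP : ∀ {φ ψ} → Prov (imp φ ψ) → Prov φ → Prov ψ)
  where

  and iff : F → F → F
  and φ ψ = neg (imp φ (neg ψ))
  iff φ ψ = and (imp φ ψ) (imp ψ φ)

  infix 3 _⊢_
  data _⊢_ (Γ : List F) : F → Set where
    hyp : ∀ {φ} → φ ∈ Γ → Γ ⊢ φ
    thm : ∀ {φ} → Prov φ → Γ ⊢ φ
    app : ∀ {φ ψ} → Γ ⊢ imp φ ψ → Γ ⊢ φ → Γ ⊢ ψ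

  private variable
    Γ Δ : List F
    φ ψ χ φ′ ψ′ : F

  ⊢-weaken : Γ ⊆ Δ → Γ ⊢ φ → Δ ⊢ φ
  ⊢-weaken s (hyp p) = hyp (s p)
  ⊢-weaken s (thm p) = thm p
  ⊢-weaken s (app d e) = app (⊢-weaken s d) (⊢-weaken s e)

  ⊢-closed : [] ⊢ φ → Prov φ
  ⊢-closed (thm p) = p
  ⊢-closed (app d e) = MP (⊢-closed d) (⊢-closed e)

  ⊢-id : Prov (imp φ φ)
  ⊢-id {φ = φ} = MP (MP (S φ (imp φ φ) φ) (K φ (imp φ φ))) (K φ φ)

  deduction : (φ ∷ Γ) ⊢ ψ → Γ ⊢ imp φ ψ
  deduction (hyp (here refl)) = thm ⊢-id
  deduction (hyp (there p)) = app (thm (K _ _)) (hyp p)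
  deduction (thm p) = app (thm (K _ _)) (thm p)
  deduction (app d e) = app (app (thm (S _ _ _)) (deduction d)) (deduction e)

  cut : Γ ⊢ φ → (φ ∷ Γ) ⊢ ψ → Γ ⊢ ψ
  cut d e = app (deduction e) d

  ⊢-explode : Γ ⊢ neg φ → Γ ⊢ imp φ ψ
  ⊢-explode h = app (thm (N _ _)) (app (thm (K _ _)) h)

  ⊢-contradiction : Γ ⊢ φ → Γ ⊢ neg φ → Γ ⊢ ψ
  ⊢-contradiction d e = app (⊢-explode e) d

  ⊢-¬¬-elim : Γ ⊢ neg (neg φ) → Γ ⊢ φ
  ⊢-¬¬-elim h = app (app (thm (N _ _)) (⊢-explode h)) h

  ⊢-by-contradiction : (neg φ ∷ Γ) ⊢ ψ → (neg φ ∷ Γ) ⊢ neg ψ → Γ ⊢ φ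
  ⊢-by-contradiction {φ = φ} d e =
    app (app (thm (N φ (imp φ φ))) (deduction (⊢-contradiction d e))) (thm ⊢-id)

  private
    swap-head : (φ ∷ Γ) ⊆ (φ ∷ ψ ∷ Γ)
    swap-head (here p) = here p
    swap-head (there q) = there (there q)

  ⊢-¬-intro : (φ ∷ Γ) ⊢ ψ → (φ ∷ Γ) ⊢ neg ψ → Γ ⊢ neg φ
  ⊢-¬-intro {φ = φ} {Γ = Γ} d e = ⊢-by-contradiction (lift d) (lift e)
    where
    lift : ∀ {χ} → (φ ∷ Γ) ⊢ χ → (neg (neg φ) ∷ Γ) ⊢ χ
    lift d = cut (⊢-¬¬-elim (hyp (here refl))) (⊢-weaken swap-head d)

  ⊢-∧-intro : Γ ⊢ φ → Γ ⊢ ψ → Γ ⊢ and φ ψ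
  ⊢-∧-intro d e = ⊢-¬-intro (⊢-weaken there e) (app (hyp (here refl)) (⊢-weaken there d))

  ⊢-∧-elimˡ : Γ ⊢ and φ ψ → Γ ⊢ φ
  ⊢-∧-elimˡ h = ⊢-by-contradiction (⊢-explode (hyp (here refl))) (⊢-weaken there h)

  ⊢-∧-elimʳ : Γ ⊢ and φ ψ → Γ ⊢ ψ
  ⊢-∧-elimʳ h = ⊢-by-contradiction (app (thm (K _ _)) (hyp (here refl))) (⊢-weaken there h)

  ⊢-↔-intro : (φ ∷ Γ) ⊢ ψ → (ψ ∷ Γ) ⊢ φ → Γ ⊢ iff φ ψ
  ⊢-↔-intro d e = ⊢-∧-intro (deduction d) (deduction e)

  ⊢-↔-elimˡ : Γ ⊢ iff φ ψ → Γ ⊢ φ → Γ ⊢ ψ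
  ⊢-↔-elimˡ h = app (⊢-∧-elimˡ h)

  ⊢-↔-elimʳ : Γ ⊢ iff φ ψ → Γ ⊢ ψ → Γ ⊢ φ
  ⊢-↔-elimʳ h = app (⊢-∧-elimʳ h)

  ⊢-by-cases : (φ ∷ Γ) ⊢ ψ → (neg φ ∷ Γ) ⊢ ψ → Γ ⊢ ψ
  ⊢-by-cases d e = ⊢-by-contradiction
    (⊢-¬-intro (⊢-weaken swap-head d) (hyp (there (here refl))))
    (⊢-¬-intro (⊢-weaken swap-head e) (hyp (there (here refl))))

  Consistent : List F → Set
  Consistent Γ = ¬ (Σ F λ χ → (Γ ⊢ χ) × (Γ ⊢ neg χ))

  consistent-neg : Consistent Γ → ¬ Consistent (φ ∷ Γ) → Consistent (neg φ ∷ Γ)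
  consistent-neg c nc (χ , d , e) = nc λ (χ′ , d′ , e′) → c (χ′ , cut φ-holds d′ , cut φ-holds e′)
    where φ-holds = ⊢-by-contradiction d e

  ↔-refl : Prov (iff φ φ)
  ↔-refl = ⊢-closed (⊢-↔-intro (hyp (here refl)) (hyp (here refl)))

  ↔-trans : Prov (iff φ ψ) → Prov (iff ψ χ) → Prov (iff φ χ)
  ↔-trans p q = ⊢-closed (⊢-↔-intro
    (⊢-↔-elimˡ (thm q) (⊢-↔-elimˡ (thm p) (hyp (here refl))))
    (⊢-↔-elimʳ (thm p) (⊢-↔-elimʳ (thm q) (hyp (here refl)))))

  ↔-neg : Prov (iff φ ψ) → Prov (iff (neg φ) (neg ψ))
  ↔-neg p = ⊢-closed (⊢-↔-intro
    (⊢-¬-intro (⊢-↔-elimʳ (thm p) (hyp (here refl))) (hyp (there (here refl))))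
    (⊢-¬-intro (⊢-↔-elimˡ (thm p) (hyp (here refl))) (hyp (there (here refl)))))

  ↔-imp : Prov (iff φ φ′) → Prov (iff ψ ψ′) → Prov (iff (imp φ ψ) (imp φ′ ψ′))
  ↔-imp p q = ⊢-closed (⊢-↔-intro
    (deduction (⊢-↔-elimˡ (thm q) (app (hyp (there (here refl))) (⊢-↔-elimʳ (thm p) (hyp (here refl))))))
    (deduction (⊢-↔-elimʳ (thm q) (app (hyp (there (here refl))) (⊢-↔-elimˡ (thm p) (hyp (here refl)))))))

  ↔-mpʳ : Prov (iff φ ψ) → Prov ψ → Prov φ
  ↔-mpʳ p q = ⊢-closed (⊢-↔-elimʳ (thm p) (thm q))

Constant : SDModel → (Assignment → Set) → Set
Constant W P = (u v : Assignment) → W u → W v → Iff (P u) (P v)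

module Classical (lem : ExcludedMiddle 0ℓ) where

  ¬¬-elim : ∀ {P : Set} → ¬ ¬ P → P
  ¬¬-elim {P} nnp with lem {P}
  ... | yes p = p
  ... | no np = ⊥-elim (nnp np)

  ∧-sem : ∀ {P Q : Set} → Iff (¬ (P → ¬ Q)) (P × Q)
  ∧-sem = (λ h → ¬¬-elim (λ np → h (λ p _ → np p)) , ¬¬-elim (λ nq → h (λ _ q → nq q))) ,
          (λ (p , q) f → f p q)

  ∨-sem : ∀ {P Q : Set} → Iff (¬ P → Q) (P ⊎ Q)
  ∨-sem {P} = (λ h → [ inj₁ , inj₂ ∘ h ] (dec⇒⊎ (lem {P}))) ,
              (λ { (inj₁ p) np → ⊥-elim (np p) ; (inj₂ q) _ → q })
    where
    dec⇒⊎ : Dec P → P ⊎ ¬ P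
    dec⇒⊎ (yes p) = inj₁ p
    dec⇒⊎ (no np) = inj₂ np

  ↔-sem : ∀ {P Q : Set} → Iff (¬ ((P → Q) → ¬ (Q → P))) (Iff P Q)
  ↔-sem = ∧-sem

  private variable
    W : SDModel
    P Q : Assignment → Set

  constant-cong : (∀ u → W u → Iff (P u) (Q u)) → Iff (Constant W P) (Constant W Q)
  constant-cong e =
    (λ k u v wu wv → (λ q → proj₁ (e v wv) (proj₁ (k u v wu wv) (proj₂ (e u wu) q))) ,
                     (λ q → proj₁ (e u wu) (proj₂ (k u v wu wv) (proj₂ (e v wv) q)))) ,
    (λ k u v wu wv → (λ p → proj₂ (e v wv) (proj₁ (k u v wu wv) (proj₁ (e u wu) p))) ,
                     (λ p → proj₂ (e u wu) (proj₂ (k u v wu wv) (proj₁ (e v wv) p))))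

  constant-¬ : Iff (Constant W P) (Constant W (¬_ ∘ P))
  constant-¬ =
    (λ k u v wu wv → (λ nu pv → nu (proj₂ (k u v wu wv) pv)) , (λ nv pu → nv (proj₁ (k u v wu wv) pu))) ,
    (λ k u v wu wv → (λ pu → ¬¬-elim λ nv → proj₂ (k u v wu wv) nv pu) ,
                     (λ pv → ¬¬-elim λ nu → proj₁ (k u v wu wv) nu pv))

  constant-∧ : Constant W P → Constant W Q → Constant W (λ u → ¬ (P u → ¬ Q u))
  constant-∧ kP kQ u v wu wv =
    (λ h f → h (λ p q → f (proj₁ (kP u v wu wv) p) (proj₁ (kQ u v wu wv) q))) ,
    (λ h f → h (λ p q → f (proj₂ (kP u v wu wv) p) (proj₂ (kQ u v wu wv) q)))

  constant-mp : ∀ {w} → W w → P w → Constant W P → Constant W (λ u → P u → Q u) → Constant W Q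
  constant-mp {w = w} ww p kP kPQ u v wu wv =
    (λ q → proj₁ (kPQ u v wu wv) (λ _ → q) (proj₁ (kP w v ww wv) p)) ,
    (λ q → proj₂ (kPQ u v wu wv) (λ _ → q) (proj₁ (kP w u ww wu) p))

  constant-∧-self : ∀ {R : Set} → Iff R (Constant W P) → Constant W (λ u → ¬ (P u → ¬ R))
  constant-∧-self (toK , _) u v wu wv =
    (λ h → proj₂ ∧-sem (let (p , r) = proj₁ ∧-sem h in proj₁ (toK r u v wu wv) p , r)) ,
    (λ h → proj₂ ∧-sem (let (p , r) = proj₁ ∧-sem h in proj₂ (toK r u v wu wv) p , r))

data FormC : Set where
  atomC : ℕ → FormC
  negC  : FormC → FormC
  impC  : FormC → FormC → FormC
  CC    : FormC → FormC

andC iffC : FormC → FormC → FormC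
andC φ ψ = negC (impC φ (negC ψ))
iffC φ ψ = andC (impC φ ψ) (impC ψ φ)

topC : FormC
topC = impC (negC (atomC 0)) (negC (atomC 0))

data ProvC : FormC → Set where
  ax-K    : ∀ φ ψ → ProvC (impC φ (impC ψ φ))
  ax-S    : ∀ φ ψ χ → ProvC (impC (impC φ (impC ψ χ)) (impC (impC φ ψ) (impC φ χ)))
  ax-N    : ∀ φ ψ → ProvC (impC (impC (negC φ) (negC ψ)) (impC ψ φ))
  ax-C⊤   : ProvC (CC topC)
  ax-C¬   : ∀ φ → ProvC (iffC (CC φ) (CC (negC φ)))
  ax-CC   : ∀ φ → ProvC (CC (andC φ (CC φ)))
  ax-C∧   : ∀ φ ψ → ProvC (impC (andC (CC φ) (CC ψ)) (CC (andC φ ψ)))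
  ax-Cimp : ∀ φ ψ → ProvC (impC (andC (andC φ (CC φ)) (CC (impC φ ψ))) (CC ψ))
  mp      : ∀ {φ ψ} → ProvC (impC φ ψ) → ProvC φ → ProvC ψ
  eq-C    : ∀ {φ ψ} → ProvC (iffC φ ψ) → ProvC (iffC (CC φ) (CC ψ))

_,_⊨C_ : SDModel → Assignment → FormC → Set
W , w ⊨C atomC p = w p ≡ true
W , w ⊨C negC φ = ¬ (W , w ⊨C φ)
W , w ⊨C impC φ ψ = (W , w ⊨C φ) → (W , w ⊨C ψ)
W , w ⊨C CC φ = Constant W (λ u → W , u ⊨C φ)

ValidC : FormC → Set₁
ValidC φ = (W : SDModel) (w : Assignment) → W w → W , w ⊨C φ

open Hilbert negC impC ProvC ax-K ax-S ax-N mp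

necessitation : ∀ {φ} → ProvC φ → ProvC (CC φ)
necessitation p = ↔-mpʳ (eq-C (⊢-closed (⊢-↔-intro (thm ⊢-id) (thm p)))) ax-C⊤

-- ¬ C φ is provably equivalent to ¬ (φ ∧ C φ) ∧ ¬ (¬ φ ∧ C ¬ φ), which is constant by ax-CC.
CC-CC : ∀ φ → ProvC (CC (CC φ))
CC-CC φ = ↔-mpʳ (ax-C¬ (CC φ)) (⊢-closed (⊢-↔-elimˡ (thm (eq-C equivalent)) (thm constant)))
  where
  A = andC φ (CC φ)
  B = andC (negC φ) (CC (negC φ))
  Y = andC (negC A) (negC B)
  constant : ProvC (CC Y)
  constant = mp (ax-C∧ (negC A) (negC B)) (⊢-closed (⊢-∧-intro
    (⊢-↔-elimˡ (thm (ax-C¬ A)) (thm (ax-CC φ)))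
    (⊢-↔-elimˡ (thm (ax-C¬ B)) (thm (ax-CC (negC φ))))))
  equivalent : ProvC (iffC Y (negC (CC φ)))
  equivalent = ⊢-closed (⊢-↔-intro
    (⊢-¬-intro (hyp (here refl)) (⊢-by-cases
      (⊢-contradiction (⊢-∧-intro (hyp (here refl)) (hyp (there (here refl))))
                       (⊢-∧-elimˡ (hyp (there (there (here refl))))))
      (⊢-contradiction (⊢-∧-intro (hyp (here refl)) (⊢-↔-elimˡ (thm (ax-C¬ φ)) (hyp (there (here refl)))))
                       (⊢-∧-elimʳ (hyp (there (there (here refl))))))))
    (⊢-∧-intro
      (⊢-¬-intro (⊢-∧-elimʳ (hyp (here refl))) (hyp (there (here refl))))
      (⊢-¬-intro (⊢-↔-elimʳ (thm (ax-C¬ φ)) (⊢-∧-elimʳ (hyp (here refl)))) (hyp (there (here refl))))))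

subformulas : FormC → List FormC
subformulas (atomC p) = atomC p ∷ []
subformulas (negC φ) = negC φ ∷ subformulas φ
subformulas (impC φ ψ) = impC φ ψ ∷ subformulas φ ++ subformulas ψ
subformulas (CC φ) = CC φ ∷ subformulas φ

∈-subformulas : ∀ φ → φ ∈ subformulas φ
∈-subformulas (atomC p) = here refl
∈-subformulas (negC φ) = here refl
∈-subformulas (impC φ ψ) = here refl
∈-subformulas (CC φ) = here refl

dec-≡-true : ∀ {P : Set} (d : Dec P) {b} → does d ≡ b → Iff (b ≡ true) P
dec-≡-true (yes p) refl = (λ _ → p) , (λ _ → refl)
dec-≡-true (no ¬p) refl = (λ ()) , (λ p → ⊥-elim (¬p p))

module Completeness (lem : ExcludedMiddle 0ℓ) where

  Decides : List FormC → List FormC → Set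
  Decides Γ L = ∀ {φ} → φ ∈ L → (Γ ⊢ φ) ⊎ (Γ ⊢ negC φ)

  lindenbaum : ∀ {Γ} L → Consistent Γ → Σ (List FormC) λ Δ → Γ ⊆ Δ × Consistent Δ × Decides Δ L
  lindenbaum [] c = _ , id , c , λ ()
  lindenbaum {Γ} (φ ∷ L) c with lem {Consistent (φ ∷ Γ)}
  ... | yes c′ = let (Δ , φΓ⊆Δ , cΔ , dΔ) = lindenbaum L c′ in
    Δ , φΓ⊆Δ ∘ there , cΔ , λ { (here refl) → inj₁ (hyp (φΓ⊆Δ (here refl))) ; (there m) → dΔ m }
  ... | no nc = let (Δ , φΓ⊆Δ , cΔ , dΔ) = lindenbaum L (consistent-neg c nc) in
    Δ , φΓ⊆Δ ∘ there , cΔ , λ { (here refl) → inj₂ (hyp (φΓ⊆Δ (here refl))) ; (there m) → dΔ m }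

  module Canonical (L : List FormC) (Γ₀ : List FormC)
                   (Γ₀-consistent : Consistent Γ₀) (Γ₀-decides : Decides Γ₀ L) where

    Global : FormC → Set
    Global φ = (Γ₀ ⊢ φ) × (Γ₀ ⊢ CC φ)

    global? : Decidable Global
    global? φ = lem

    G : List FormC
    G = filter global? (L ++ map negC L)

    global-derivable : ∀ {Γ φ} → (∀ {ψ} → ψ ∈ Γ → Global ψ) → Γ ⊢ φ → Global φ
    global-derivable gΓ (hyp p) = gΓ p
    global-derivable gΓ (thm p) = thm p , thm (necessitation p)
    global-derivable gΓ (app d e) with global-derivable gΓ d | global-derivable gΓ e
    ... | (d₁ , d₂) | (e₁ , e₂) = app d₁ e₁ , app (thm (ax-Cimp _ _)) (⊢-∧-intro (⊢-∧-intro e₁ e₂) d₂)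

    G-global : ∀ {φ} → G ⊢ φ → Global φ
    G-global = global-derivable (proj₂ ∘ ∈-filter⁻ global? {xs = L ++ map negC L})

    ∈G : ∀ {φ} → φ ∈ L → Global φ → φ ∈ G
    ∈G m = ∈-filter⁺ global? (∈-++⁺ˡ m)

    ¬∈G : ∀ {φ} → φ ∈ L → Global (negC φ) → negC φ ∈ G
    ¬∈G m = ∈-filter⁺ global? (∈-++⁺ʳ L (∈-map⁺ negC m))

    record World : Set where
      field
        ctx        : List FormC
        consistent : Consistent ctx
        decides    : Decides ctx L
        entails-G  : ∀ {φ} → φ ∈ G → ctx ⊢ φ
    open World

    agrees-with-Γ₀ : ∀ {φ} (Δ : World) → φ ∈ L → Γ₀ ⊢ CC φ → Iff (ctx Δ ⊢ φ) (Γ₀ ⊢ φ)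
    agrees-with-Γ₀ {φ} Δ m c with Γ₀-decides m
    ... | inj₁ d = (λ _ → d) , (λ _ → entails-G Δ (∈G m (d , c)))
    ... | inj₂ e = (λ d → ⊥-elim (consistent Δ (φ , d , entails-G Δ (¬∈G m (e , C¬φ))))) ,
                   (λ d → ⊥-elim (Γ₀-consistent (φ , d , e)))
      where C¬φ = ⊢-↔-elimˡ (thm (ax-C¬ φ)) c

    world-with : ∀ φ → Consistent (φ ∷ G) → Σ World λ Δ → ctx Δ ⊢ φ
    world-with φ c = let (Δ , φG⊆Δ , cΔ , dΔ) = lindenbaum L c in
      record { ctx = Δ ; consistent = cΔ ; decides = dΔ ; entails-G = hyp ∘ φG⊆Δ ∘ there } ,
      hyp (φG⊆Δ (here refl))

    consistent-with : ∀ {φ} → ¬ (Γ₀ ⊢ CC φ) → Consistent (φ ∷ G)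
    consistent-with {φ} nc (χ , d , e) =
      nc (⊢-↔-elimʳ (thm (ax-C¬ φ)) (proj₂ (G-global (⊢-¬-intro d e))))

    consistent-without : ∀ {φ} → ¬ (Γ₀ ⊢ CC φ) → Consistent (negC φ ∷ G)
    consistent-without nc (χ , d , e) = nc (proj₂ (G-global (⊢-by-contradiction d e)))

    valuation : World → Assignment
    valuation Δ n = does (lem {ctx Δ ⊢ atomC n})

    -- Points of an SD-model are assignments, so without function extensionality a point is
    -- matched with a world only pointwise.
    model : SDModel
    model w = Σ World λ Δ → valuation Δ ≗ w

    TruthAt : FormC → Set
    TruthAt φ = (Δ : World) {w : Assignment} → valuation Δ ≗ w → Iff (model , w ⊨C φ) (ctx Δ ⊢ φ)

    nonconstant : ∀ {φ} → φ ∈ L → TruthAt φ → ¬ (Γ₀ ⊢ CC φ) → ¬ Constant model (λ u → model , u ⊨C φ)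
    nonconstant {φ} m truth nc k =
      let (Δ₁ , d₁) = world-with φ (consistent-with nc)
          (Δ₂ , d₂) = world-with (negC φ) (consistent-without nc)
          sat₁ = proj₂ (truth Δ₁ λ _ → refl) d₁
          sat₂ = proj₁ (k _ _ (Δ₁ , λ _ → refl) (Δ₂ , λ _ → refl)) sat₁
      in consistent Δ₂ (φ , proj₁ (truth Δ₂ λ _ → refl) sat₂ , d₂)

    truth : ∀ φ → subformulas φ ⊆ L → TruthAt φ
    truth (atomC n) s Δ e = dec-≡-true (lem {ctx Δ ⊢ atomC n}) (e n)
    truth (negC φ) s Δ e =
      (λ ns → [ (λ d → ⊥-elim (ns (proj₂ IH d))) , id ] (decides Δ (s (there (∈-subformulas φ))))) ,
      (λ d sφ → consistent Δ (φ , proj₁ IH sφ , d))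
      where IH = truth φ (s ∘ there) Δ e
    truth (impC φ ψ) s Δ e =
      (λ f → [ (λ d → app (thm (ax-K ψ φ)) (proj₁ IHψ (f (proj₂ IHφ d)))) , ⊢-explode ]
               (decides Δ (s (there (∈-++⁺ˡ (∈-subformulas φ)))))) ,
      (λ d sφ → proj₂ IHψ (app d (proj₁ IHφ sφ)))
      where
      IHφ = truth φ (s ∘ there ∘ ∈-++⁺ˡ) Δ e
      IHψ = truth ψ (s ∘ there ∘ ∈-++⁺ʳ (subformulas φ)) Δ e
    truth (CC φ) s Δ e = constant⇒⊢ , ⊢⇒constant
      where
      φ∈L = s (there (∈-subformulas φ))
      IH = truth φ (s ∘ there)
      Γ₀-agrees : Iff (ctx Δ ⊢ CC φ) (Γ₀ ⊢ CC φ)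
      Γ₀-agrees = agrees-with-Γ₀ Δ (s (here refl)) (thm (CC-CC φ))
      ⊢⇒constant : ctx Δ ⊢ CC φ → Constant model (λ u → model , u ⊨C φ)
      ⊢⇒constant d u v (Δᵤ , eᵤ) (Δᵥ , eᵥ) =
        (λ sᵤ → proj₂ (IH Δᵥ eᵥ) (proj₂ Aᵥ (proj₁ Aᵤ (proj₁ (IH Δᵤ eᵤ) sᵤ)))) ,
        (λ sᵥ → proj₂ (IH Δᵤ eᵤ) (proj₂ Aᵤ (proj₁ Aᵥ (proj₁ (IH Δᵥ eᵥ) sᵥ))))
        where
        Aᵤ = agrees-with-Γ₀ Δᵤ φ∈L (proj₁ Γ₀-agrees d)
        Aᵥ = agrees-with-Γ₀ Δᵥ φ∈L (proj₁ Γ₀-agrees d)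
      constant⇒⊢ : Constant model (λ u → model , u ⊨C φ) → ctx Δ ⊢ CC φ
      constant⇒⊢ k = [ id , (λ nd → ⊥-elim (nonconstant φ∈L IH
                       (λ c → consistent Δ (CC φ , proj₂ Γ₀-agrees c , nd)) k)) ]
                     (decides Δ (s (here refl)))

  complete : ∀ φ → ValidC φ → ProvC φ
  complete φ valid with lem {ProvC φ}
  ... | yes p = p
  ... | no np =
    let (Γ₀ , ¬φ⊆Γ₀ , c₀ , d₀) = lindenbaum (subformulas φ) ¬φ-consistent
        open Canonical (subformulas φ) Γ₀ c₀ d₀
        W₀ = record { ctx = Γ₀ ; consistent = c₀ ; decides = d₀ ; entails-G = proj₁ ∘ G-global ∘ hyp }
        Γ₀⊢φ = proj₁ (truth φ id W₀ (λ _ → refl)) (valid model _ (W₀ , λ _ → refl))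
    in ⊥-elim (c₀ (φ , Γ₀⊢φ , hyp (¬φ⊆Γ₀ (here refl))))
    where
    ¬φ-consistent : Consistent (negC φ ∷ [])
    ¬φ-consistent (χ , d , e) = np (⊢-closed (⊢-by-contradiction d e))

module Types (lem : ExcludedMiddle 0ℓ) {F : Set} (neg : F → F) (bigAnd : List F → F)
  {X : Set} (T : X → F → Set)
  (T-neg : ∀ {u φ} → Iff (T u (neg φ)) (¬ T u φ))
  (T-bigAnd : ∀ {u l} → Iff (T u (bigAnd l)) (All (T u) l))
  where
  open Signs neg

  Conj : List F → List F
  Conj xs = map bigAnd (signs neg xs)

  Agree : X → X → List F → Set
  Agree u v = All (λ φ → Iff (T u φ) (T v φ))

  Agree-sym : ∀ {u v xs} → Agree u v xs → Agree v u xs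
  Agree-sym = All.map (λ (f , g) → g , f)

  signs-agree : ∀ xs {s u v} → s ∈ signs neg xs → All (T u) s → All (T v) s → Agree u v xs
  signs-agree [] _ _ _ = []
  signs-agree (x ∷ xs) m a₁ a₂ with ∈-signs⁻ x xs m
  signs-agree (x ∷ xs) m (t₁ ∷ a₁) (t₂ ∷ a₂) | l , ml , inj₁ refl =
    ((λ _ → t₂) , (λ _ → t₁)) ∷ signs-agree xs ml a₁ a₂
  signs-agree (x ∷ xs) m (t₁ ∷ a₁) (t₂ ∷ a₂) | l , ml , inj₂ refl =
    ((λ h → ⊥-elim (proj₁ T-neg t₁ h)) , (λ h → ⊥-elim (proj₁ T-neg t₂ h))) ∷ signs-agree xs ml a₁ a₂

  signs-transfer : ∀ xs {s u v} → Agree u v xs → s ∈ signs neg xs → All (T u) s → All (T v) s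
  signs-transfer [] [] (here refl) [] = []
  signs-transfer (x ∷ xs) (e ∷ es) m a with ∈-signs⁻ x xs m
  signs-transfer (x ∷ xs) (e ∷ es) m (t ∷ a) | l , ml , inj₁ refl =
    proj₁ e t ∷ signs-transfer xs es ml a
  signs-transfer (x ∷ xs) (e ∷ es) m (t ∷ a) | l , ml , inj₂ refl =
    proj₂ T-neg (λ t′ → proj₁ T-neg t (proj₂ e t′)) ∷ signs-transfer xs es ml a

  signs-exist : ∀ u xs → ∃[ s ] s ∈ signs neg xs × All (T u) s
  signs-exist u [] = [] , here refl , []
  signs-exist u (x ∷ xs) with signs-exist u xs | lem {T u x}
  ... | l , m , a | yes t = x ∷ l , ∈-signs⁺ {xs = xs} m (here refl) , t ∷ a
  ... | l , m , a | no nt = neg x ∷ l , ∈-signs⁺ {xs = xs} m (there (here refl)) , proj₂ T-neg nt ∷ a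

  conj-agree : ∀ {xs c u v} → c ∈ Conj xs → T u c → T v c → Agree u v xs
  conj-agree m tu tv with ∈-map⁻ bigAnd m
  ... | s , ms , refl = signs-agree _ ms (proj₁ T-bigAnd tu) (proj₁ T-bigAnd tv)

  conj-transfer : ∀ {xs c u v} → Agree u v xs → c ∈ Conj xs → T u c → T v c
  conj-transfer e m tu with ∈-map⁻ bigAnd m
  ... | s , ms , refl = proj₂ T-bigAnd (signs-transfer _ e ms (proj₁ T-bigAnd tu))

  conj-exists : ∀ u xs → ∃[ c ] c ∈ Conj xs × T u c
  conj-exists u xs with signs-exist u xs
  ... | s , ms , a = bigAnd s , ∈-map⁺ bigAnd ms , proj₂ T-bigAnd a

module LogicD (lem : ExcludedMiddle 0ℓ) where
  open Classical lem
  private module C = Completeness lem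
  private module H = Hilbert negD impD ProvD ax-K ax-S ax-N mp

  embed : FormC → FormD
  embed (atomC p) = atomD p
  embed (negC φ) = negD (embed φ)
  embed (impC φ ψ) = impD (embed φ) (embed ψ)
  embed (CC φ) = CD (embed φ)

  embed-prov : ∀ {φ} → ProvC φ → ProvD (embed φ)
  embed-prov (ax-K φ ψ) = ax-K _ _
  embed-prov (ax-S φ ψ χ) = ax-S _ _ _
  embed-prov (ax-N φ ψ) = ax-N _ _
  embed-prov ax-C⊤ = ax-C⊤
  embed-prov (ax-C¬ φ) = ax-C¬ _
  embed-prov (ax-CC φ) = ax-CC _
  embed-prov (ax-C∧ φ ψ) = ax-C∧ _ _
  embed-prov (ax-Cimp φ ψ) = ax-Cimp _ _
  embed-prov (mp p q) = mp (embed-prov p) (embed-prov q)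
  embed-prov (eq-C p) = eq-C (embed-prov p)

  D-rhs : List FormD → FormD → FormD
  D-rhs φs ψ = bigOrD (map (λ χ → boxD (iffD χ ψ)) (DNFD φs))

  module _ {W : SDModel} where

    ⊨-bigAnd : ∀ {u} l → Iff (W , u ⊨D bigAndD l) (All (W , u ⊨D_) l)
    ⊨-bigAnd [] = (λ _ → []) , (λ _ h → h)
    ⊨-bigAnd (φ ∷ []) = (_∷ []) , All.head
    ⊨-bigAnd (φ ∷ l@(_ ∷ _)) =
      (λ h → proj₁ (proj₁ ∧-sem h) ∷ proj₁ (⊨-bigAnd l) (proj₂ (proj₁ ∧-sem h))) ,
      (λ a → proj₂ ∧-sem (All.head a , proj₂ (⊨-bigAnd l) (All.tail a)))

    ⊨-bigOr : ∀ {u} l → Iff (W , u ⊨D bigOrD l) (Any (W , u ⊨D_) l)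
    ⊨-bigOr [] = (λ h → ⊥-elim (h λ p np → np p)) , λ ()
    ⊨-bigOr (φ ∷ []) = here , λ { (here p) → p }
    ⊨-bigOr (φ ∷ l@(_ ∷ _)) =
      Any.fromSum ∘ Sum.map₂ (proj₁ (⊨-bigOr l)) ∘ proj₁ ∨-sem ,
      proj₂ ∨-sem ∘ Sum.map₂ (proj₂ (⊨-bigOr l)) ∘ Any.toSum

    open Types lem negD bigAndD (W ,_⊨D_) (id , id) (λ {_} {l} → ⊨-bigAnd l)

    ⊨-C : ∀ w {φ} → Iff (W , w ⊨D CD φ) (Constant W (W ,_⊨D φ))
    ⊨-C _ = (λ k u v wu wv → k u v wu wv tt) , (λ k u v wu wv _ → k u v wu wv)

    ⊨-box : ∀ {w φ} → W w → Iff (W , w ⊨D boxD φ) (∀ u → W u → W , u ⊨D φ)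
    ⊨-box ww =
      (λ h u wu → let (p , k) = proj₁ ∧-sem h in proj₁ (k _ u ww wu tt) p) ,
      (λ h → proj₂ ∧-sem (h _ ww , λ u v wu wv _ → (λ _ → h v wv) , (λ _ → h u wu)))

    agreeD⇒All : ∀ {u v} φs → agreeD W u v φs → Agree u v φs
    agreeD⇒All [] _ = []
    agreeD⇒All (φ ∷ φs) (e , es) = e ∷ agreeD⇒All φs es

    All⇒agreeD : ∀ {u v} φs → Agree u v φs → agreeD W u v φs
    All⇒agreeD [] _ = tt
    All⇒agreeD (φ ∷ φs) (e ∷ es) = e , All⇒agreeD φs es

    dnf-transfer : ∀ {φs U u v} → U ∈ sublists (ConjD φs) → Agree u v φs →
                   W , u ⊨D bigOrD U → W , v ⊨D bigOrD U
    dnf-transfer {U = U} U∈ e t with find (proj₁ (⊨-bigOr U) t)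
    ... | c , c∈U , tc = proj₂ (⊨-bigOr U) (lose c∈U (conj-transfer e (∈-sublists-⊆ _ U∈ c∈U) tc))

    -- The witness disjunction collects the types over φs that are realised together with ψ.
    dep⇒rhs : ∀ {w} φs ψ → W w → W , w ⊨D depD φs ψ → W , w ⊨D D-rhs φs ψ
    dep⇒rhs φs ψ ww d =
      proj₂ (⊨-bigOr (map (λ χ → boxD (iffD χ ψ)) (DNFD φs)))
        (lose box∈ (proj₂ (⊨-box {φ = iffD (bigOrD U) ψ} ww) λ u wu → proj₂ ↔-sem (χ⇒ψ u wu , ψ⇒χ u wu)))
      where
      Realised : FormD → Set
      Realised c = ∃[ u ] W u × W , u ⊨D c × W , u ⊨D ψ
      realised? : Decidable Realised
      realised? c = lem
      U = filter realised? (ConjD φs)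
      box∈ : boxD (iffD (bigOrD U) ψ) ∈ map (λ χ → boxD (iffD χ ψ)) (DNFD φs)
      box∈ = ∈-map⁺ (λ χ → boxD (iffD χ ψ)) (∈-map⁺ bigOrD (filter-∈-sublists realised? (ConjD φs)))
      χ⇒ψ : ∀ u → W u → W , u ⊨D bigOrD U → W , u ⊨D ψ
      χ⇒ψ u wu t with find (proj₁ (⊨-bigOr U) t)
      ... | c , c∈U , tc with ∈-filter⁻ realised? {xs = ConjD φs} c∈U
      ... | c∈Conj , (u′ , wu′ , tc′ , tψ) =
        proj₂ (d u u′ wu wu′ (All⇒agreeD φs (conj-agree c∈Conj tc tc′))) tψ
      ψ⇒χ : ∀ u → W u → W , u ⊨D ψ → W , u ⊨D bigOrD U
      ψ⇒χ u wu tψ with conj-exists u φs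
      ... | c , c∈Conj , tc = proj₂ (⊨-bigOr U) (lose (∈-filter⁺ realised? c∈Conj (u , wu , tc , tψ)) tc)

    rhs⇒dep : ∀ {w} φs ψ → W w → W , w ⊨D D-rhs φs ψ → W , w ⊨D depD φs ψ
    rhs⇒dep φs ψ ww r u v wu wv a with find (proj₁ (⊨-bigOr (map (λ χ → boxD (iffD χ ψ)) (DNFD φs))) r)
    ... | x , x∈ , tx with ∈-map⁻ (λ χ → boxD (iffD χ ψ)) x∈
    ... | χ , χ∈ , refl with ∈-map⁻ bigOrD χ∈
    ... | U , U∈ , refl =
      (λ tu → proj₁ (χ↔ψ v wv) (dnf-transfer U∈ ag (proj₂ (χ↔ψ u wu) tu))) ,
      (λ tv → proj₁ (χ↔ψ u wu) (dnf-transfer U∈ (Agree-sym ag) (proj₂ (χ↔ψ v wv) tv)))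
      where
      χ↔ψ : ∀ u → W u → Iff (W , u ⊨D bigOrD U) (W , u ⊨D ψ)
      χ↔ψ u wu = proj₁ ↔-sem (proj₁ (⊨-box {φ = iffD (bigOrD U) ψ} ww) tx u wu)
      ag = agreeD⇒All φs a

  mutual
    depth : FormD → ℕ
    depth (atomD _) = 0
    depth (negD φ) = depth φ
    depth (impD φ ψ) = depth φ ⊔ depth ψ
    depth (depD [] ψ) = depth ψ
    depth (depD φs@(_ ∷ _) ψ) = suc (depths φs ⊔ depth ψ)

    depths : List FormD → ℕ
    depths [] = 0
    depths (φ ∷ φs) = depth φ ⊔ depths φs

  depths-All : ∀ φs → All (λ φ → depth φ ≤ depths φs) φs
  depths-All [] = []
  depths-All (φ ∷ φs) =
    m≤m⊔n _ _ ∷ All.map (λ h → ≤-trans h (m≤n⊔m (depth φ) (depths φs))) (depths-All φs)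

  module _ {m : ℕ} where

    bigAnd-depth : ∀ {l} → All (λ φ → depth φ ≤ m) l → depth (bigAndD l) ≤ m
    bigAnd-depth [] = z≤n
    bigAnd-depth (p ∷ []) = p
    bigAnd-depth (p ∷ ps@(_ ∷ _)) = ⊔-lub p (bigAnd-depth ps)

    bigOr-depth : ∀ {l} → All (λ φ → depth φ ≤ m) l → depth (bigOrD l) ≤ m
    bigOr-depth [] = z≤n
    bigOr-depth (p ∷ []) = p
    bigOr-depth (p ∷ ps@(_ ∷ _)) = ⊔-lub p (bigOr-depth ps)

    D-rhs-depth′ : ∀ {φs ψ} → All (λ φ → depth φ ≤ m) φs → depth ψ ≤ m → depth (D-rhs φs ψ) ≤ m
    D-rhs-depth′ {φs} {ψ} bφs bψ =
      bigOr-depth (All-map⁺ {f = λ χ → boxD (iffD χ ψ)} (All.map (λ {χ} → box-depth {χ})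
        (All-map⁺ {f = bigOrD} (All.map bigOr-depth (All-sublists
          (All-map⁺ {f = bigAndD} (All.map bigAnd-depth (Signs.All-signs negD id bφs))))))))
      where
      box-depth : ∀ {χ} → depth χ ≤ m → depth (boxD (iffD χ ψ)) ≤ m
      box-depth bχ = let b = ⊔-lub (⊔-lub bχ bψ) (⊔-lub bψ bχ) in ⊔-lub b b

  D-rhs-depth : ∀ φs ψ → depth (D-rhs φs ψ) ≤ depths φs ⊔ depth ψ
  D-rhs-depth φs ψ = D-rhs-depth′ (All.map (λ h → ≤-trans h (m≤m⊔n _ _)) (depths-All φs)) (m≤n⊔m _ _)

  -- The fuel n bounds the depth in every use, so the zero-fuel clause is never reached.
  translate : ℕ → FormD → FormC
  translate n (atomD p) = atomC p
  translate n (negD φ) = negC (translate n φ)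
  translate n (impD φ ψ) = impC (translate n φ) (translate n ψ)
  translate n (depD [] ψ) = CC (translate n ψ)
  translate zero (depD (_ ∷ _) _) = atomC 0
  translate (suc n) (depD φs@(_ ∷ _) ψ) = translate n (D-rhs φs ψ)

  translate-sem : ∀ {n} φ → depth φ ≤ n → ∀ {W w} → W w → Iff (W , w ⊨D φ) (W , w ⊨C translate n φ)
  translate-sem (atomD p) _ _ = id , id
  translate-sem (negD φ) b ww = Iff-¬ (translate-sem φ b ww)
  translate-sem (impD φ ψ) b ww =
    Iff-→ (translate-sem φ (≤-trans (m≤m⊔n _ _) b) ww) (translate-sem ψ (≤-trans (m≤n⊔m _ _) b) ww)
  translate-sem (depD [] ψ) b {w = w} ww = Iff-trans (⊨-C w) (constant-cong λ u wu → translate-sem ψ b wu)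
  translate-sem {suc n} (depD φs@(_ ∷ _) ψ) (s≤s b) ww =
    Iff-trans (dep⇒rhs φs ψ ww , rhs⇒dep φs ψ ww)
              (translate-sem (D-rhs φs ψ) (≤-trans (D-rhs-depth φs ψ) b) ww)

  translate-prov : ∀ {n} φ → depth φ ≤ n → ProvD (iffD φ (embed (translate n φ)))
  translate-prov (atomD p) _ = H.↔-refl
  translate-prov (negD φ) b = H.↔-neg (translate-prov φ b)
  translate-prov (impD φ ψ) b =
    H.↔-imp (translate-prov φ (≤-trans (m≤m⊔n _ _) b)) (translate-prov ψ (≤-trans (m≤n⊔m _ _) b))
  translate-prov (depD [] ψ) b = eq-C (translate-prov ψ b)
  translate-prov {suc n} (depD (φ ∷ φs) ψ) (s≤s b) =
    H.↔-trans (ax-D φ φs ψ) (translate-prov (D-rhs (φ ∷ φs) ψ) (≤-trans (D-rhs-depth (φ ∷ φs) ψ) b))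

  complete : ∀ φ → ValidD φ → ProvD φ
  complete φ valid = H.↔-mpʳ (translate-prov φ ≤-refl)
    (embed-prov (C.complete _ λ W w ww → proj₁ (translate-sem φ ≤-refl ww) (valid W w ww)))

  sound : ∀ φ → ProvD φ → ValidD φ
  sound _ (ax-K φ ψ) W w ww = λ p _ → p
  sound _ (ax-S φ ψ χ) W w ww = λ f g p → f p (g p)
  sound _ (ax-N φ ψ) W w ww = λ h q → ¬¬-elim λ np → h np q
  sound _ ax-C⊤ W w ww = λ u v _ _ _ → (λ _ → id) , (λ _ → id)
  sound _ (ax-C¬ φ) W w ww =
    proj₂ ↔-sem (Iff-trans (⊨-C w) (Iff-trans constant-¬ (Iff-sym (⊨-C w {φ = negD φ}))))
  sound _ (ax-CC φ) W w ww = proj₂ (⊨-C w {φ = andD φ (CD φ)}) (constant-∧-self (⊨-C w {φ = φ}))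
  sound _ (ax-C∧ φ ψ) W w ww h =
    let (cφ , cψ) = proj₁ ∧-sem h
    in proj₂ (⊨-C w {φ = andD φ ψ}) (constant-∧ (proj₁ (⊨-C w) cφ) (proj₁ (⊨-C w) cψ))
  sound _ (ax-Cimp φ ψ) W w ww h =
    let (φ∧Cφ , cφψ) = proj₁ ∧-sem h
        (p , cφ) = proj₁ ∧-sem φ∧Cφ
    in proj₂ (⊨-C w) (constant-mp ww p (proj₁ (⊨-C w) cφ) (proj₁ (⊨-C w {φ = impD φ ψ}) cφψ))
  sound _ (ax-D φ φs ψ) W w ww = proj₂ ↔-sem (dep⇒rhs (φ ∷ φs) ψ ww , rhs⇒dep (φ ∷ φs) ψ ww)
  sound _ (mp p q) W w ww = sound _ p W w ww (sound _ q W w ww)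
  sound _ (eq-C {φ} {ψ} p) W w ww = proj₂ ↔-sem (Iff-trans (⊨-C w)
    (Iff-trans (constant-cong λ u wu → proj₁ ↔-sem (sound _ p W u wu)) (Iff-sym (⊨-C w {φ = ψ}))))

module LogicI (lem : ExcludedMiddle 0ℓ) where
  open Classical lem
  private module C = Completeness lem
  private module H = Hilbert negI impI ProvI ax-K ax-S ax-N mp

  embed : FormC → FormI
  embed (atomC p) = atomI p
  embed (negC φ) = negI (embed φ)
  embed (impC φ ψ) = impI (embed φ) (embed ψ)
  embed (CC φ) = CI (embed φ)

  embed-prov : ∀ {φ} → ProvC φ → ProvI (embed φ)
  embed-prov (ax-K φ ψ) = ax-K _ _
  embed-prov (ax-S φ ψ χ) = ax-S _ _ _
  embed-prov (ax-N φ ψ) = ax-N _ _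
  embed-prov ax-C⊤ = ax-C⊤
  embed-prov (ax-C¬ φ) = ax-C¬ _
  embed-prov (ax-CC φ) = ax-CC _
  embed-prov (ax-C∧ φ ψ) = ax-C∧ _ _
  embed-prov (ax-Cimp φ ψ) = ax-Cimp _ _
  embed-prov (mp p q) = mp (embed-prov p) (embed-prov q)
  embed-prov (eq-C p) = eq-C (embed-prov p)

  I-conjunct : FormI → FormI → FormI → FormI
  I-conjunct φ θ ψ = impI (andI (diaI' (andI θ φ)) (diaI' (andI θ ψ))) (diaI' (andI θ (andI φ ψ)))

  I-conjuncts : List FormI → List FormI → List FormI → List FormI
  I-conjuncts φs θs ψs =
    concatMap (λ φ → concatMap (λ θ → map (I-conjunct φ θ) (ConjI ψs)) (ConjI θs)) (ConjI φs)

  I-rhs : List⁺ FormI → List FormI → List⁺ FormI → FormI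
  I-rhs Φ θs Ψ = indRHS (toList Φ) θs (toList Ψ)

  All-I-conjuncts : ∀ {P : FormI → Set} φs θs ψs →
    Iff (All P (I-conjuncts φs θs ψs))
        (∀ {φ θ ψ} → φ ∈ ConjI φs → θ ∈ ConjI θs → ψ ∈ ConjI ψs → P (I-conjunct φ θ ψ))
  All-I-conjuncts φs θs ψs =
    (λ a φ∈ θ∈ ψ∈ → All.lookup (All-map⁻
       (All.lookup (proj₁ (All-concatMap _) (All.lookup (proj₁ (All-concatMap _) a) φ∈)) θ∈)) ψ∈) ,
    (λ h → proj₂ (All-concatMap _) (All.tabulate λ φ∈ → proj₂ (All-concatMap _)
             (All.tabulate λ θ∈ → All-map⁺ (All.tabulate λ ψ∈ → h φ∈ θ∈ ψ∈))))

  module _ {W : SDModel} where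

    ⊨-bigAnd : ∀ {u} l → Iff (W , u ⊨I bigAndI l) (All (W , u ⊨I_) l)
    ⊨-bigAnd [] = (λ _ → []) , (λ _ h → h)
    ⊨-bigAnd (φ ∷ []) = (_∷ []) , All.head
    ⊨-bigAnd (φ ∷ l@(_ ∷ _)) =
      (λ h → proj₁ (proj₁ ∧-sem h) ∷ proj₁ (⊨-bigAnd l) (proj₂ (proj₁ ∧-sem h))) ,
      (λ a → proj₂ ∧-sem (All.head a , proj₂ (⊨-bigAnd l) (All.tail a)))

    ⊨-C : ∀ w {φ} → Iff (W , w ⊨I CI φ) (Constant W (W ,_⊨I φ))
    ⊨-C _ =
      (λ h u v wu wv → let (_ , _ , _ , (zu , _) , (zv , _)) = h u v wu wv tt in Iff-trans (Iff-sym zu) zv) ,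
      (λ k u v wu wv _ → u , wu , tt , ((id , id) , tt) , (k u v wu wv , tt))

    ⊨-box : ∀ {w φ} → W w → Iff (W , w ⊨I boxI' φ) (∀ u → W u → W , u ⊨I φ)
    ⊨-box {w} ww =
      (λ h u wu → let (p , k) = proj₁ ∧-sem h in proj₁ (proj₁ (⊨-C w) k w u ww wu) p) ,
      (λ h → proj₂ ∧-sem (h w ww , proj₂ (⊨-C w) λ u v wu wv → (λ _ → h v wv) , (λ _ → h u wu)))

    Satisfiable : FormI → Set
    Satisfiable φ = ∃[ u ] W u × W , u ⊨I φ

    ⊨-dia : ∀ {w φ} → W w → Iff (W , w ⊨I diaI' φ) (Satisfiable φ)
    ⊨-dia {φ = φ} ww =
      (λ h → ¬¬-elim λ ns → h (proj₂ (⊨-box {φ = negI φ} ww) λ u wu t → ns (u , wu , t))) ,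
      (λ (u , wu , t) b → proj₁ (⊨-box {φ = negI φ} ww) b u wu t)

    ⊨-I-conjunct : ∀ {w φ θ ψ} → W w → Iff (W , w ⊨I I-conjunct φ θ ψ)
      (Satisfiable (andI θ φ) × Satisfiable (andI θ ψ) → Satisfiable (andI θ (andI φ ψ)))
    ⊨-I-conjunct {φ = φ} {θ} {ψ} ww =
      Iff-→ (Iff-trans ∧-sem (Iff-× (⊨-dia {φ = andI θ φ} ww) (⊨-dia {φ = andI θ ψ} ww)))
            (⊨-dia {φ = andI θ (andI φ ψ)} ww)

    open Types lem negI bigAndI (W ,_⊨I_) (id , id) (λ {_} {l} → ⊨-bigAnd l)

    agreeI⇒All : ∀ {u v} θs → agreeI W u v θs → Agree u v θs
    agreeI⇒All [] _ = []
    agreeI⇒All (θ ∷ θs) (e , es) = e ∷ agreeI⇒All θs es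

    All⇒agreeI : ∀ {u v} θs → Agree u v θs → agreeI W u v θs
    All⇒agreeI [] _ = tt
    All⇒agreeI (θ ∷ θs) (e ∷ es) = e , All⇒agreeI θs es

    agreeI⁺⇒All : ∀ {u v} Φ → agreeI⁺ W u v Φ → Agree u v (toList Φ)
    agreeI⁺⇒All (φ List⁺.∷ φs) (e , es) = e ∷ agreeI⇒All φs es

    All⇒agreeI⁺ : ∀ {u v} Φ → Agree u v (toList Φ) → agreeI⁺ W u v Φ
    All⇒agreeI⁺ (φ List⁺.∷ φs) (e ∷ es) = e , All⇒agreeI φs es

    ind⇒rhs : ∀ {w} Φ θs Ψ → W w → W , w ⊨I indI Φ θs Ψ → W , w ⊨I I-rhs Φ θs Ψ
    ind⇒rhs Φ θs Ψ ww h =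
      proj₂ (⊨-bigAnd _) (proj₂ (All-I-conjuncts (toList Φ) θs (toList Ψ)) λ φ∈ θ∈ ψ∈ →
        proj₂ (⊨-I-conjunct ww) λ ((u₁ , wu₁ , t₁) , (u₂ , wu₂ , t₂)) →
          let (tθ₁ , tφ₁) = proj₁ ∧-sem t₁
              (tθ₂ , tψ₂) = proj₁ ∧-sem t₂
              (v , wv , aθ , aφ , aψ) = h u₁ u₂ wu₁ wu₂ (All⇒agreeI θs (conj-agree θ∈ tθ₁ tθ₂))
              tθ = conj-transfer (Agree-sym (agreeI⇒All θs aθ)) θ∈ tθ₁
              tφ = conj-transfer (Agree-sym (agreeI⁺⇒All Φ aφ)) φ∈ tφ₁
              tψ = conj-transfer (Agree-sym (agreeI⁺⇒All Ψ aψ)) ψ∈ tψ₂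
          in v , wv , proj₂ ∧-sem (tθ , proj₂ ∧-sem (tφ , tψ)))

    -- The types of w₁ over θs and Φ and of w₂ over Ψ select the conjunct that yields the witness.
    rhs⇒ind : ∀ {w} Φ θs Ψ → W w → W , w ⊨I I-rhs Φ θs Ψ → W , w ⊨I indI Φ θs Ψ
    rhs⇒ind Φ θs Ψ ww r w₁ w₂ ww₁ ww₂ a =
      let (θ , θ∈ , tθ₁) = conj-exists w₁ θs
          (φ , φ∈ , tφ₁) = conj-exists w₁ (toList Φ)
          (ψ , ψ∈ , tψ₂) = conj-exists w₂ (toList Ψ)
          tθ₂ = conj-transfer (agreeI⇒All θs a) θ∈ tθ₁
          conjunct = proj₁ (All-I-conjuncts (toList Φ) θs (toList Ψ)) (proj₁ (⊨-bigAnd _) r) φ∈ θ∈ ψ∈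
          (v , wv , t) = proj₁ (⊨-I-conjunct ww) conjunct
                           ((w₁ , ww₁ , proj₂ ∧-sem (tθ₁ , tφ₁)) , (w₂ , ww₂ , proj₂ ∧-sem (tθ₂ , tψ₂)))
          (tθ , tφψ) = proj₁ ∧-sem t
          (tφ , tψ) = proj₁ ∧-sem tφψ
      in v , wv , All⇒agreeI θs (conj-agree θ∈ tθ tθ₁) ,
         All⇒agreeI⁺ Φ (conj-agree φ∈ tφ tφ₁) , All⇒agreeI⁺ Ψ (conj-agree ψ∈ tψ tψ₂)

  IsC : List⁺ FormI → List FormI → List⁺ FormI → Set
  IsC Φ θs Ψ = ∃[ φ ] (Φ , θs , Ψ) ≡ (List⁺.[ φ ] , [] , List⁺.[ φ ])

  -- CI φ = indI [φ] [] [φ] stays primitive: its instance of the I axiom mentions CI again.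
  mutual
    depth : FormI → ℕ
    depth (atomI _) = 0
    depth (negI φ) = depth φ
    depth (impI φ ψ) = depth φ ⊔ depth ψ
    depth (indI Φ θs Ψ) with lem {IsC Φ θs Ψ}
    ... | yes (φ , refl) = depth φ
    ... | no _ = suc (depths⁺ Φ ⊔ depths θs ⊔ depths⁺ Ψ)

    depths : List FormI → ℕ
    depths [] = 0
    depths (φ ∷ φs) = depth φ ⊔ depths φs

    depths⁺ : List⁺ FormI → ℕ
    depths⁺ (φ List⁺.∷ φs) = depth φ ⊔ depths φs

  depth-CI : ∀ φ → depth (CI φ) ≡ depth φ
  depth-CI φ with lem {IsC List⁺.[ φ ] [] List⁺.[ φ ]}
  ... | yes (_ , refl) = refl
  ... | no ¬C = ⊥-elim (¬C (φ , refl))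

  depths-All : ∀ φs → All (λ φ → depth φ ≤ depths φs) φs
  depths-All [] = []
  depths-All (φ ∷ φs) =
    m≤m⊔n _ _ ∷ All.map (λ h → ≤-trans h (m≤n⊔m (depth φ) (depths φs))) (depths-All φs)

  module _ {m : ℕ} where

    bigAnd-depth : ∀ {l} → All (λ φ → depth φ ≤ m) l → depth (bigAndI l) ≤ m
    bigAnd-depth [] = z≤n
    bigAnd-depth (p ∷ []) = p
    bigAnd-depth (p ∷ ps@(_ ∷ _)) = ⊔-lub p (bigAnd-depth ps)

    dia-depth : ∀ {φ} → depth φ ≤ m → depth (diaI' φ) ≤ m
    dia-depth {φ} b = ⊔-lub b (subst (_≤ m) (sym (depth-CI (negI φ))) b)

    I-rhs-depth′ : ∀ {φs θs ψs} → All (λ φ → depth φ ≤ m) φs → All (λ φ → depth φ ≤ m) θs →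
                   All (λ φ → depth φ ≤ m) ψs → depth (indRHS φs θs ψs) ≤ m
    I-rhs-depth′ {φs} {θs} {ψs} bφs bθs bψs =
      bigAnd-depth (proj₂ (All-I-conjuncts φs θs ψs) λ {φ} {θ} {ψ} φ∈ θ∈ ψ∈ →
        let bφ = All.lookup (conj-depth bφs) φ∈
            bθ = All.lookup (conj-depth bθs) θ∈
            bψ = All.lookup (conj-depth bψs) ψ∈
        in ⊔-lub (⊔-lub (dia-depth {andI θ φ} (⊔-lub bθ bφ)) (dia-depth {andI θ ψ} (⊔-lub bθ bψ)))
                 (dia-depth {andI θ (andI φ ψ)} (⊔-lub bθ (⊔-lub bφ bψ))))
      where
      conj-depth : ∀ {xs} → All (λ φ → depth φ ≤ m) xs → All (λ φ → depth φ ≤ m) (ConjI xs)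
      conj-depth bxs = All-map⁺ {f = bigAndI} (All.map bigAnd-depth (Signs.All-signs negI id bxs))

  I-rhs-depth : ∀ Φ θs Ψ → depth (I-rhs Φ θs Ψ) ≤ depths⁺ Φ ⊔ depths θs ⊔ depths⁺ Ψ
  I-rhs-depth Φ θs Ψ = I-rhs-depth′
    (All.map (λ h → ≤-trans h (≤-trans (m≤m⊔n _ _) (m≤m⊔n _ _))) (depths-All (toList Φ)))
    (All.map (λ h → ≤-trans h (≤-trans (m≤n⊔m (depths⁺ Φ) _) (m≤m⊔n _ _))) (depths-All θs))
    (All.map (λ h → ≤-trans h (m≤n⊔m (depths⁺ Φ ⊔ depths θs) _)) (depths-All (toList Ψ)))

  translate : ℕ → FormI → FormC
  translate n (atomI p) = atomC p
  translate n (negI φ) = negC (translate n φ)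
  translate n (impI φ ψ) = impC (translate n φ) (translate n ψ)
  translate n (indI Φ θs Ψ) with lem {IsC Φ θs Ψ}
  ... | yes (φ , refl) = CC (translate n φ)
  translate zero (indI Φ θs Ψ) | no _ = atomC 0
  translate (suc n) (indI Φ θs Ψ) | no _ = translate n (I-rhs Φ θs Ψ)

  translate-sem : ∀ {n} φ → depth φ ≤ n → ∀ {W w} → W w → Iff (W , w ⊨I φ) (W , w ⊨C translate n φ)
  translate-sem (atomI p) _ _ = id , id
  translate-sem (negI φ) b ww = Iff-¬ (translate-sem φ b ww)
  translate-sem (impI φ ψ) b ww =
    Iff-→ (translate-sem φ (≤-trans (m≤m⊔n _ _) b) ww) (translate-sem ψ (≤-trans (m≤n⊔m _ _) b) ww)
  translate-sem (indI Φ θs Ψ) b ww with lem {IsC Φ θs Ψ}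
  translate-sem (indI _ _ _) b {w = w} ww | yes (φ , refl) =
    Iff-trans (⊨-C w) (constant-cong λ u wu → translate-sem φ b wu)
  translate-sem {suc n} (indI Φ θs Ψ) (s≤s b) ww | no _ =
    Iff-trans (ind⇒rhs Φ θs Ψ ww , rhs⇒ind Φ θs Ψ ww)
              (translate-sem (I-rhs Φ θs Ψ) (≤-trans (I-rhs-depth Φ θs Ψ) b) ww)

  translate-prov : ∀ {n} φ → depth φ ≤ n → ProvI (iffI φ (embed (translate n φ)))
  translate-prov (atomI p) _ = H.↔-refl
  translate-prov (negI φ) b = H.↔-neg (translate-prov φ b)
  translate-prov (impI φ ψ) b =
    H.↔-imp (translate-prov φ (≤-trans (m≤m⊔n _ _) b)) (translate-prov ψ (≤-trans (m≤n⊔m _ _) b))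
  translate-prov (indI Φ θs Ψ) b with lem {IsC Φ θs Ψ}
  translate-prov (indI _ _ _) b | yes (φ , refl) = eq-C (translate-prov φ b)
  translate-prov {suc n} (indI Φ θs Ψ) (s≤s b) | no _ =
    H.↔-trans (ax-I (List⁺.head Φ) (List⁺.tail Φ) θs (List⁺.head Ψ) (List⁺.tail Ψ))
              (translate-prov (I-rhs Φ θs Ψ) (≤-trans (I-rhs-depth Φ θs Ψ) b))

  complete : ∀ φ → ValidI φ → ProvI φ
  complete φ valid = H.↔-mpʳ (translate-prov φ ≤-refl)
    (embed-prov (C.complete _ λ W w ww → proj₁ (translate-sem φ ≤-refl ww) (valid W w ww)))

  sound : ∀ φ → ProvI φ → ValidI φ
  sound _ (ax-K φ ψ) W w ww = λ p _ → p
  sound _ (ax-S φ ψ χ) W w ww = λ f g p → f p (g p)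
  sound _ (ax-N φ ψ) W w ww = λ h q → ¬¬-elim λ np → h np q
  sound _ ax-C⊤ W w ww = proj₂ (⊨-C w {φ = topI}) λ u v _ _ → (λ _ → id) , (λ _ → id)
  sound _ (ax-C¬ φ) W w ww =
    proj₂ ↔-sem (Iff-trans (⊨-C w) (Iff-trans constant-¬ (Iff-sym (⊨-C w {φ = negI φ}))))
  sound _ (ax-CC φ) W w ww = proj₂ (⊨-C w {φ = andI φ (CI φ)}) (constant-∧-self (⊨-C w {φ = φ}))
  sound _ (ax-C∧ φ ψ) W w ww h =
    let (cφ , cψ) = proj₁ ∧-sem h
    in proj₂ (⊨-C w {φ = andI φ ψ}) (constant-∧ (proj₁ (⊨-C w) cφ) (proj₁ (⊨-C w) cψ))
  sound _ (ax-Cimp φ ψ) W w ww h =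
    let (φ∧Cφ , cφψ) = proj₁ ∧-sem h
        (p , cφ) = proj₁ ∧-sem φ∧Cφ
    in proj₂ (⊨-C w) (constant-mp ww p (proj₁ (⊨-C w) cφ) (proj₁ (⊨-C w {φ = impI φ ψ}) cφψ))
  sound _ (ax-I φ φs θs ψ ψs) W w ww =
    let Φ = φ List⁺.∷ φs ; Ψ = ψ List⁺.∷ ψs
    in proj₂ ↔-sem (ind⇒rhs Φ θs Ψ ww , rhs⇒ind Φ θs Ψ ww)
  sound _ (mp p q) W w ww = sound _ p W w ww (sound _ q W w ww)
  sound _ (eq-C {φ} {ψ} p) W w ww = proj₂ ↔-sem (Iff-trans (⊨-C w)
    (Iff-trans (constant-cong λ u wu → proj₁ ↔-sem (sound _ p W u wu)) (Iff-sym (⊨-C w {φ = ψ}))))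

theorem7p6 : ExcludedMiddle 0ℓ →
    (((φ : FormD) → ProvD φ → ValidD φ) × ((φ : FormD) → ValidD φ → ProvD φ))
    × (((φ : FormI) → ProvI φ → ValidI φ) × ((φ : FormI) → ValidI φ → ProvI φ))
theorem7p6 lem = (LogicD.sound lem , LogicD.complete lem) , (LogicI.sound lem , LogicI.complete lem)
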